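{- Let $U$ be a word over the alphabet $\{\mathtt{a},\mathtt{b},\mathtt{x}\}$ that starts and ends with the letter $\mathtt{x}$, and let $\alpha=r(U)^{1/(|U|+5)}$. Then there exists a constant $c>0$ such that $f_4(n)\geqslant c\,\alpha^n$ for all $n\in\mathbb{N}$.
   Context: A square is a finite non-empty word of the form $XX$ with $X$ non-empty; a word is square-free if it contains no square as a factor. If $W=UXXV$ with $X$ non-empty, replacing $W$ by $UXV$ is a square reduction. A reduct of $W$ is any square-free word obtainable from $W$ by a finite sequence of square reductions, and $r(W)$ is the number of distinct reducts of $W$. $|U|$ denotes the length of $U$. For $k\geqslant1$, $f_k(n)$ is the maximum of $r(W)$ over all words $W$ of length $n$ over an alphabet of size $k$. -}

module Defs where

open import Data.Nat using (ℕ; _≤_)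
open import Data.Fin using (Fin)
open import Data.List using (List; []; _∷_; _++_; length)
open import Data.List.Membership.Propositional using (_∈_)
open import Data.List.Relation.Unary.Unique.Propositional using (Unique)
open import Data.Product using (Σ; ∃; _×_)
open import Relation.Binary.PropositionalEquality using (_≡_; _≢_)
open import Relation.Binary.Construct.Closure.ReflexiveTransitive using (Star)
open import Relation.Nullary using (¬_)
open import Function.Bundles using (_⇔_)

data Letter : Set where
  a b x : Letter

module _ {A : Set} where

  HasSquare : List A → Set
  HasSquare W = ∃ λ (u : List A) → ∃ λ (X : List A) → ∃ λ (v : List A) →
    X ≢ [] × W ≡ u ++ X ++ X ++ v

  SquareFree : List A → Set
  SquareFree W = ¬ HasSquare W

  data _⟶_ : List A → List A → Set where
    reduce : ∀ (u X v : List A) → X ≢ [] → (u ++ X ++ X ++ v) ⟶ (u ++ X ++ v)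

  Reduct : List A → List A → Set
  Reduct W V = Star _⟶_ W V × SquareFree V

  ReductList : List A → List (List A) → Set
  ReductList W L = Unique L × (∀ V → (V ∈ L) ⇔ Reduct W V)

  -- r(W) ≡ m : W has exactly m distinct reducts
  RCount : List A → ℕ → Set
  RCount W m = ∃ λ L → ReductList W L × length L ≡ m

-- f_k(n) ≡ m : m is the maximum of r(W) over words W of length n over an alphabet of size k
FValue : ℕ → ℕ → ℕ → Set
FValue k n m =
  (∃ λ (W : List (Fin k)) → length W ≡ n × RCount W m)
  × (∀ (W : List (Fin k)) (m′ : ℕ) → length W ≡ n → RCount W m′ → m′ ≤ m)

-- Embed {a, b, x} into {a, b, x, ♯} and code four letters by the words aba, axa, bab, bxb. If c₀ ⋯ cₖ is a
-- square-free word over four letters, then  code c₀ ♯ U ♯ code c₁ ♯ U ♯ ⋯ ♯ U ♯ code cₖ  reduces to each of the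
-- r(U)ᵏ words obtained by replacing every U by one of its reducts, and these are square-free: a square that is not
-- inside a single ♯-free block is aligned with the separators up to one block on each side, and as no code word
-- straddles the junction of two others while reducts of U, unlike code words, begin and end with x, it would
-- produce a square in the square-free sequence c₀ ∗ c₁ ∗ ⋯ ∗ cₖ of block types. Padding the first separator with
-- extra ♯'s, which reduce away, reaches every length n ≥ 3 + k (|U| + 5); hence f₄(n) ≥ r(U)^(⌊n/(|U|+5)⌋ - 1).
-- The construction with U = x also yields the square-free words of every length over four letters.

module Submission where

open import Defs hiding (a; b; x)
open import Data.Empty using (⊥-elim)
open import Data.Fin using (Fin; zero; suc)
import Data.Fin.Properties as Fin
open import Data.List
  using (List; []; _∷_; _++_; [_]; _∷ʳ_; map; length; head; last; take; drop; replicate; concatMap; deduplicate;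
         cartesianProductWith; intercalate; intersperse)
open import Data.List.Properties
  using (++-assoc; ++-identityʳ; ++-conicalʳ; map-++; map-injective; map-∘; map-id-local; ∷-injectiveˡ; ∷-injectiveʳ;
         take++drop≡id; length-++; length-map; length-replicate; length-take; head-map; last-map; ≡-dec)
open import Data.List.Membership.Propositional using (_∈_; _∉_; find; lose)
open import Data.List.Membership.Propositional.Properties
  using (∈-map⁺; ∈-map⁻; ∈-++⁺ʳ; ∈-concatMap⁺; ∈-concatMap⁻; ∈-∃++; ∈-deduplicate⁺; ∈-deduplicate⁻; ∈-cartesianProductWith⁻)
import Data.List.Membership.DecPropositional as DecMembership
open import Data.List.Relation.Unary.Any using (Any; here; there)
open import Data.List.Relation.Unary.All as All using (All; []; _∷_; tabulate)
open import Data.List.Relation.Unary.All.Properties using (All¬⇒¬Any)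
open import Data.List.Relation.Unary.AllPairs using ([]; _∷_)
open import Data.List.Relation.Unary.Unique.Propositional using (Unique)
import Data.List.Relation.Unary.Unique.Propositional.Properties as Unique
open import Data.List.Relation.Unary.Unique.DecPropositional.Properties using (deduplicate-!)
open import Data.Maybe as Maybe using (Maybe; just; nothing)
open import Data.Maybe.Properties using (just-injective) renaming (≡-dec to ≡-decᵐ)
open import Data.Nat using (ℕ; zero; suc; _+_; _*_; _^_; _∸_; _≤_; _<_; z≤n; s≤s; NonZero; >-nonZero)
open import Data.Nat.DivMod using (_/_; _%_; m/n*n≤m; m≡m%n+[m/n]*n; m%n<n)
open import Data.Nat.Induction using (<-wellFounded)
open import Data.Nat.Properties
  using (≤-refl; ≤-trans; ≤-pred; <⇒≤; +-suc; +-assoc; n≤1+n; m≤n+m; m≤m*n; m≤n⇒m⊓n≡m; m∸n+n≡m; +-mono-≤; +-monoˡ-≤;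
         +-monoʳ-<; *-monoʳ-≤; *-identityˡ; ^-monoʳ-≤; ^-monoˡ-≤; ^-distribˡ-+-*; ^-*-assoc; m^n>0; module ≤-Reasoning)
open import Data.Nat.Tactic.RingSolver using (solve-∀)
open import Data.Product using (∃; ∃₂; _×_; _,_; proj₁; proj₂; map₁)
open import Data.Sum using (_⊎_; inj₁; inj₂)
open import Function using (_∘_)
open import Function.Bundles using (_⇔_; mk⇔; Equivalence)
open import Function.Definitions using (Injective)
open import Induction.WellFounded using (Acc; acc)
open import Relation.Binary.Construct.Closure.ReflexiveTransitive using (Star; ε; _◅_; _◅◅_; gmap)
open import Relation.Binary.Definitions using (DecidableEquality)
open import Relation.Binary.PropositionalEquality hiding ([_])
open import Relation.Nullary using (¬_; Dec; yes; no)
open import Relation.Nullary.Decidable using (from-yes; ¬?; map′; _→-dec_; _⊎-dec_)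

private variable
  A B : Set
  W W′ : List A

++-assoc₃ : ∀ (u X v q : List A) → (u ++ X ++ v) ++ q ≡ u ++ X ++ v ++ q
++-assoc₃ u X v q = trans (++-assoc u _ q) (cong (u ++_) (++-assoc X v q))

++-assoc-square : ∀ (u X v q : List A) → (u ++ X ++ X ++ v) ++ q ≡ u ++ X ++ X ++ v ++ q
++-assoc-square u X v q = trans (++-assoc₃ u X (X ++ v) q) (cong (λ z → u ++ X ++ z) (++-assoc X v q))

map-++₃ : ∀ (f : A → B) u X v → map f (u ++ X ++ v) ≡ map f u ++ map f X ++ map f v
map-++₃ f u X v = trans (map-++ f u (X ++ v)) (cong (map f u ++_) (map-++ f X v))

map-++-square : ∀ (f : A → B) u X v → map f (u ++ X ++ X ++ v) ≡ map f u ++ map f X ++ map f X ++ map f v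
map-++-square f u X v = trans (map-++₃ f u X (X ++ v)) (cong (λ z → map f u ++ map f X ++ z) (map-++ f X v))

¬HasSquare-[] : ¬ HasSquare {A} []
¬HasSquare-[] ([] , [] , _ , X≢[] , _) = X≢[] refl

¬HasSquare-[_] : ∀ (c : A) → ¬ HasSquare [ c ]
¬HasSquare-[ c ] ([] , [] , _ , X≢[] , _) = X≢[] refl
¬HasSquare-[ c ] ([] , _ ∷ [] , _ , _ , ())
¬HasSquare-[ c ] ([] , _ ∷ _ ∷ _ , _ , _ , ())
¬HasSquare-[ c ] (_ ∷ u , X , v , X≢[] , eq) = ¬HasSquare-[] (u , X , v , X≢[] , ∷-injectiveʳ eq)

HasSquare-++ʳ : ∀ {w : List A} v → HasSquare w → HasSquare (w ++ v)
HasSquare-++ʳ v (u , X , v′ , X≢[] , refl) = u , X , v′ ++ v , X≢[] , ++-assoc-square u X v′ v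

HasSquare-take : ∀ k (w : List A) → HasSquare (take k w) → HasSquare w
HasSquare-take k w sq = subst HasSquare (take++drop≡id k w) (HasSquare-++ʳ (drop k w) sq)

map-++-split : ∀ (f : A → B) w {p q} → map f w ≡ p ++ q →
               ∃₂ λ p′ q′ → w ≡ p′ ++ q′ × map f p′ ≡ p × map f q′ ≡ q
map-++-split f w {[]} eq = [] , w , refl , refl , eq
map-++-split f (c ∷ w) {_ ∷ p} eq with map-++-split f w {p} (∷-injectiveʳ eq)
... | p′ , q′ , refl , refl , refl = c ∷ p′ , q′ , refl , cong (_∷ _) (∷-injectiveˡ eq) , refl

HasSquare-map⁻ : ∀ {f : A → B} → Injective _≡_ _≡_ f → ∀ w → HasSquare (map f w) → HasSquare w
HasSquare-map⁻ {f = f} inj w (u , X , v , X≢[] , eq)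
  with map-++-split f w {u} eq
... | u′ , r , refl , refl , eq₁ with map-++-split f r {X} eq₁
... | X₁ , r′ , refl , refl , eq₂ with map-++-split f r′ {X} eq₂
... | X₂ , v′ , refl , eq₃ , refl with map-injective inj eq₃
... | refl = u′ , X₁ , v′ , (λ { refl → X≢[] refl }) , refl

HasSquare-overlap : ∀ (us Bs vs : List A) {c e d} → e ≡ c ⊎ e ≡ d →
                    HasSquare (us ++ c ∷ Bs ++ e ∷ Bs ++ d ∷ vs)
HasSquare-overlap us Bs vs {c} {d = d} (inj₁ refl) = us , c ∷ Bs , d ∷ vs , (λ ()) , refl
HasSquare-overlap us Bs vs {c} {e} (inj₂ refl) =
  us ++ [ c ] , Bs ++ [ e ] , vs , Bs∷ʳe≢[] , reassoc
  where
  open ≡-Reasoning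
  Bs∷ʳe≢[] : Bs ++ [ e ] ≢ []
  Bs∷ʳe≢[] eq with ++-conicalʳ Bs [ e ] eq
  ... | ()
  reassoc : us ++ c ∷ Bs ++ e ∷ Bs ++ e ∷ vs ≡ (us ++ [ c ]) ++ (Bs ++ [ e ]) ++ (Bs ++ [ e ]) ++ vs
  reassoc = begin
    us ++ c ∷ Bs ++ e ∷ Bs ++ e ∷ vs                          ≡⟨ ++-assoc us [ c ] _ ⟨
    (us ++ [ c ]) ++ Bs ++ e ∷ Bs ++ e ∷ vs                   ≡⟨ cong ((us ++ [ c ]) ++_) (++-assoc Bs [ e ] _) ⟨
    (us ++ [ c ]) ++ (Bs ++ [ e ]) ++ Bs ++ e ∷ vs            ≡⟨ cong (λ z → (us ++ [ c ]) ++ (Bs ++ [ e ]) ++ z) (++-assoc Bs [ e ] vs) ⟨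
    (us ++ [ c ]) ++ (Bs ++ [ e ]) ++ (Bs ++ [ e ]) ++ vs     ∎

map-overlap : ∀ (f : A → B) us Bs vs c e d →
  map f (us ++ c ∷ Bs ++ e ∷ Bs ++ d ∷ vs) ≡ map f us ++ f c ∷ map f Bs ++ f e ∷ map f Bs ++ f d ∷ map f vs
map-overlap f us Bs vs c e d
  rewrite map-++ f us (c ∷ Bs ++ e ∷ Bs ++ d ∷ vs) | map-++ f Bs (e ∷ Bs ++ d ∷ vs) | map-++ f Bs (d ∷ vs) = refl

length-cartesianProductWith : ∀ {C : Set} (f : A → B → C) xs ys →
                              length (cartesianProductWith f xs ys) ≡ length xs * length ys
length-cartesianProductWith f [] ys = refl
length-cartesianProductWith f (z ∷ xs) ys =
  trans (length-++ (map (f z) ys)) (cong₂ _+_ (length-map (f z) ys) (length-cartesianProductWith f xs ys))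

length-++-replicate : ∀ {A : Set} (p : List A) j s q → length (p ++ replicate j s ++ q) ≡ j + length (p ++ q)
length-++-replicate p j s q = begin
  length (p ++ replicate j s ++ q)            ≡⟨ length-++ p ⟩
  length p + length (replicate j s ++ q)      ≡⟨ cong (length p +_) (length-++ (replicate j s)) ⟩
  length p + (length (replicate j s) + length q) ≡⟨ cong (λ k → length p + (k + length q)) (length-replicate j) ⟩
  length p + (j + length q)                   ≡⟨ solve-j (length p) j (length q) ⟩
  j + (length p + length q)                   ≡⟨ cong (j +_) (length-++ p) ⟨
  j + length (p ++ q)                         ∎
  where
  open ≡-Reasoning
  solve-j : ∀ l j k → l + (j + k) ≡ j + (l + k)
  solve-j = solve-∀

*-∸1-≤ : ∀ k L → k * L ≤ L + (k ∸ 1) * L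
*-∸1-≤ zero L = z≤n
*-∸1-≤ (suc k) L = ≤-refl

^-≤-quotient : ∀ {r m} L n .{{_ : NonZero r}} .{{_ : NonZero L}} → r ^ (n / L ∸ 1) ≤ m → r ^ n ≤ r ^ (L + L) * m ^ L
^-≤-quotient {r} {m} L n r^≤m = begin
  r ^ n                                       ≤⟨ ^-monoʳ-≤ r n≤ ⟩
  r ^ ((L + L) + (n / L ∸ 1) * L)             ≡⟨ ^-distribˡ-+-* r (L + L) _ ⟩
  r ^ (L + L) * r ^ ((n / L ∸ 1) * L)         ≡⟨ cong (r ^ (L + L) *_) (^-*-assoc r (n / L ∸ 1) L) ⟨
  r ^ (L + L) * (r ^ (n / L ∸ 1)) ^ L         ≤⟨ *-monoʳ-≤ (r ^ (L + L)) (^-monoˡ-≤ L r^≤m) ⟩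
  r ^ (L + L) * m ^ L                         ∎
  where
  open ≤-Reasoning
  n≤ : n ≤ (L + L) + (n / L ∸ 1) * L
  n≤ = begin
    n                             ≡⟨ m≡m%n+[m/n]*n n L ⟩
    n % L + n / L * L             ≤⟨ +-mono-≤ (<⇒≤ (m%n<n n L)) (*-∸1-≤ (n / L) L) ⟩
    L + (L + (n / L ∸ 1) * L)     ≡⟨ +-assoc L L _ ⟨
    (L + L) + (n / L ∸ 1) * L     ∎

infix 4 _⟶*_

_⟶*_ : List A → List A → Set
_⟶*_ = Star _⟶_

⟶-hasSquare : W ⟶ W′ → HasSquare W
⟶-hasSquare (reduce u X v X≢[]) = u , X , v , X≢[] , refl

⟶-length : W ⟶ W′ → length W′ < length W
⟶-length (reduce u [] v X≢[]) = ⊥-elim (X≢[] refl)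
⟶-length (reduce u (c ∷ X) v _)
  rewrite length-++ u {c ∷ X ++ c ∷ X ++ v} | length-++ u {c ∷ X ++ v}
        | length-++ X {c ∷ X ++ v} | length-++ X {v}
  = +-monoʳ-< (length u) (s≤s (+-monoʳ-< (length X) (s≤s (m≤n+m (length v) (length X)))))

⟶-++ˡ : ∀ p → W ⟶ W′ → (p ++ W) ⟶ (p ++ W′)
⟶-++ˡ p (reduce u X v X≢[]) =
  subst₂ _⟶_ (++-assoc p u _) (++-assoc p u _) (reduce (p ++ u) X v X≢[])

⟶-++ʳ : ∀ q → W ⟶ W′ → (W ++ q) ⟶ (W′ ++ q)
⟶-++ʳ q (reduce u X v X≢[]) =
  subst₂ _⟶_ (sym (++-assoc-square u X v q)) (sym (++-assoc₃ u X v q)) (reduce u X (v ++ q) X≢[])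

⟶-map : ∀ (f : A → B) → W ⟶ W′ → map f W ⟶ map f W′
⟶-map f (reduce u X v X≢[]) =
  subst₂ _⟶_ (sym (map-++-square f u X v)) (sym (map-++₃ f u X v))
         (reduce (map f u) (map f X) (map f v) (map-≢[] X X≢[]))
  where
  map-≢[] : ∀ X → X ≢ [] → map f X ≢ []
  map-≢[] [] X≢[] = ⊥-elim (X≢[] refl)
  map-≢[] (_ ∷ _) _ ()

⟶*-++ˡ : ∀ p → W ⟶* W′ → p ++ W ⟶* p ++ W′
⟶*-++ˡ p = gmap (p ++_) (⟶-++ˡ p)

⟶*-++ʳ : ∀ q → W ⟶* W′ → W ++ q ⟶* W′ ++ q
⟶*-++ʳ q = gmap (_++ q) (⟶-++ʳ q)

⟶*-map : ∀ (f : A → B) → W ⟶* W′ → map f W ⟶* map f W′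
⟶*-map f = gmap (map f) (⟶-map f)

last-++-∷ : ∀ (zs : List A) y ys → last (zs ++ y ∷ ys) ≡ last (y ∷ ys)
last-++-∷ [] y ys = refl
last-++-∷ (_ ∷ []) y ys = refl
last-++-∷ (_ ∷ z ∷ zs) y ys = last-++-∷ (z ∷ zs) y ys

⟶-head : W ⟶ W′ → head W′ ≡ head W
⟶-head (reduce [] [] v X≢[]) = ⊥-elim (X≢[] refl)
⟶-head (reduce [] (_ ∷ _) v _) = refl
⟶-head (reduce (_ ∷ _) X v _) = refl

⟶-last : W ⟶ W′ → last W′ ≡ last W
⟶-last (reduce u [] v X≢[]) = ⊥-elim (X≢[] refl)
⟶-last (reduce u (c ∷ X) v _) =
  trans (last-++-∷ u c (X ++ v))
        (sym (trans (last-++-∷ u c (X ++ c ∷ X ++ v)) (last-++-∷ (c ∷ X) c (X ++ v))))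

⟶*-head : W ⟶* W′ → head W′ ≡ head W
⟶*-head ε = refl
⟶*-head (s ◅ ss) = trans (⟶*-head ss) (⟶-head s)

⟶*-last : W ⟶* W′ → last W′ ≡ last W
⟶*-last ε = refl
⟶*-last (s ◅ ss) = trans (⟶*-last ss) (⟶-last s)

replicate-⟶* : ∀ j (c : A) w → replicate j c ++ c ∷ w ⟶* c ∷ w
replicate-⟶* zero c w = ε
replicate-⟶* (suc j) c w = ⟶*-++ˡ [ c ] (replicate-⟶* j c w) ◅◅ (reduce [] [ c ] w (λ ()) ◅ ε)

∈-concatMap⁺′ : ∀ (f : A → List B) {xs x y} → x ∈ xs → y ∈ f x → y ∈ concatMap f xs
∈-concatMap⁺′ f x∈xs y∈fx = ∈-concatMap⁺ f (lose x∈xs y∈fx)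

∈-concatMap⁻′ : ∀ (f : A → List B) {xs y} → y ∈ concatMap f xs → ∃ λ x → x ∈ xs × y ∈ f x
∈-concatMap⁻′ f y∈ = find (∈-concatMap⁻ f y∈)

module Splits {A : Set} where

  splits : List A → List (List A × List A)
  splits [] = [ ([] , []) ]
  splits (c ∷ w) = ([] , c ∷ w) ∷ map (map₁ (c ∷_)) (splits w)

  ∈-splits⁺ : ∀ p q → (p , q) ∈ splits (p ++ q)
  ∈-splits⁺ [] [] = here refl
  ∈-splits⁺ [] (_ ∷ _) = here refl
  ∈-splits⁺ (c ∷ p) q = there (∈-map⁺ (map₁ (c ∷_)) (∈-splits⁺ p q))

  prefixes suffixes : List A → List (List A)
  prefixes w = map proj₁ (splits w)
  suffixes w = map proj₂ (splits w)

  ∈-prefixes⁺ : ∀ p q → p ∈ prefixes (p ++ q)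
  ∈-prefixes⁺ p q = ∈-map⁺ proj₁ (∈-splits⁺ p q)

  ∈-suffixes⁺ : ∀ p q → q ∈ suffixes (p ++ q)
  ∈-suffixes⁺ p q = ∈-map⁺ proj₂ (∈-splits⁺ p q)

  ∈-splits⁻ : ∀ w {p q} → (p , q) ∈ splits w → w ≡ p ++ q
  ∈-splits⁻ [] (here refl) = refl
  ∈-splits⁻ (c ∷ w) (here refl) = refl
  ∈-splits⁻ (c ∷ w) (there m) with ∈-map⁻ (map₁ (c ∷_)) m
  ... | _ , m′ , refl = cong (c ∷_) (∈-splits⁻ w m′)

module Reducts {A : Set} (_≟_ : DecidableEquality A) where

  open Splits

  _≟ʷ_ : DecidableEquality (List A)
  _≟ʷ_ = ≡-dec _≟_

  reduceAt : List A → List A → List A × List A → List (List A)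
  reduceAt u [] _ = []
  reduceAt u X@(_ ∷ _) (X′ , v) with X ≟ʷ X′
  ... | yes _ = [ u ++ X ++ v ]
  ... | no _ = []

  ∈-reduceAt⁻ : ∀ u X {X′ v W′} → W′ ∈ reduceAt u X (X′ , v) → X ≢ [] × X ≡ X′ × W′ ≡ u ++ X ++ v
  ∈-reduceAt⁻ u (c ∷ X) {X′} m with (c ∷ X) ≟ʷ X′ | m
  ... | yes eq | here refl = (λ ()) , eq , refl

  reduceFrom : List A → List A × List A → List (List A)
  reduceFrom u (X , s) = concatMap (reduceAt u X) (splits s)

  reduceAfter : List A × List A → List (List A)
  reduceAfter (u , s) = concatMap (reduceFrom u) (splits s)

  reductions : List A → List (List A)
  reductions W = concatMap reduceAfter (splits W)

  reductions-sound : ∀ {W W′} → W′ ∈ reductions W → W ⟶ W′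
  reductions-sound {W} m with ∈-concatMap⁻′ reduceAfter {splits W} m
  ... | (u , s) , us∈ , m₁ with ∈-concatMap⁻′ (reduceFrom u) {splits s} m₁
  ... | (X , s′) , Xs′∈ , m₂ with ∈-concatMap⁻′ (reduceAt u X) {splits s′} m₂
  ... | (X′ , v) , Xv∈ , m₃ with ∈-reduceAt⁻ u X m₃
  ... | X≢[] , refl , refl
    rewrite ∈-splits⁻ W us∈ | ∈-splits⁻ s Xs′∈ | ∈-splits⁻ s′ Xv∈ = reduce u X v X≢[]

  reductions-complete : ∀ {W W′} → W ⟶ W′ → W′ ∈ reductions W
  reductions-complete (reduce u [] v X≢[]) = ⊥-elim (X≢[] refl)
  reductions-complete (reduce u X@(_ ∷ _) v _) =
    ∈-concatMap⁺′ reduceAfter (∈-splits⁺ u (X ++ X ++ v))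
      (∈-concatMap⁺′ (reduceFrom u) (∈-splits⁺ X (X ++ v))
        (∈-concatMap⁺′ (reduceAt u X) (∈-splits⁺ X v) reduced))
    where
    reduced : u ++ X ++ v ∈ reduceAt u X (X , v)
    reduced with X ≟ʷ X
    ... | yes _ = here refl
    ... | no X≢X = ⊥-elim (X≢X refl)

  reductions-[]⇒SquareFree : ∀ {W} → reductions W ≡ [] → SquareFree W
  reductions-[]⇒SquareFree eq (u , X , v , X≢[] , refl) with subst (_ ∈_) eq (reductions-complete (reduce u X v X≢[]))
  ... | ()

  hasSquare? : ∀ W → Dec (HasSquare W)
  hasSquare? W with reductions W in eq
  ... | [] = no (reductions-[]⇒SquareFree eq)
  ... | W₁ ∷ _ = yes (⟶-hasSquare (reductions-sound {W} {W₁} (subst (_ ∈_) (sym eq) (here refl))))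

  reduct-exists : ∀ W → ∃ (Reduct W)
  reduct-exists W = go W (<-wellFounded (length W))
    where
    go : ∀ W → Acc _<_ (length W) → ∃ (Reduct W)
    go W (acc rec) with hasSquare? W
    ... | no sf = W , ε , sf
    ... | yes (u , X , v , X≢[] , refl) with go (u ++ X ++ v) (rec (⟶-length (reduce u X v X≢[])))
    ...   | V , W′⟶*V , sf = V , reduce u X v X≢[] ◅ W′⟶*V , sf

  reductsWithin : ℕ → List A → List (List A)
  reductsWithin zero W = []
  reductsWithin (suc f) W with reductions W
  ... | [] = [ W ]
  ... | W₁ ∷ Ws = concatMap (reductsWithin f) (W₁ ∷ Ws)

  reductsWithin-sound : ∀ f {W V} → V ∈ reductsWithin f W → Reduct W V
  reductsWithin-sound (suc f) {W} m with reductions W in eq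
  ... | [] with m
  ...   | here refl = ε , reductions-[]⇒SquareFree eq
  reductsWithin-sound (suc f) {W} m | W₁ ∷ Ws with ∈-concatMap⁻′ (reductsWithin f) {W₁ ∷ Ws} m
  ... | W′ , W′∈ , m′ with reductsWithin-sound f m′
  ...   | W′⟶*V , sf = reductions-sound (subst (_ ∈_) (sym eq) W′∈) ◅ W′⟶*V , sf

  reductsWithin-complete : ∀ f {W V} → length W < f → Reduct W V → V ∈ reductsWithin f W
  reductsWithin-complete (suc f) {W} _ (ε , sf) with reductions W in eq
  ... | [] = here refl
  ... | W₁ ∷ _ = ⊥-elim (sf (⟶-hasSquare (reductions-sound {W} {W₁} (subst (_ ∈_) (sym eq) (here refl)))))
  reductsWithin-complete (suc f) {W} lt (s ◅ W′⟶*V , sf) with reductions W | reductions-complete s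
  ... | W₁ ∷ Ws | W′∈ = ∈-concatMap⁺′ (reductsWithin f) W′∈
        (reductsWithin-complete f (≤-trans (⟶-length s) (≤-pred lt)) (W′⟶*V , sf))

  RCount-exists : ∀ W → ∃ (RCount W)
  RCount-exists W = length L , L , (deduplicate-! _≟ʷ_ candidates , λ V → mk⇔ sound complete) , refl
    where
    candidates = reductsWithin (suc (length W)) W
    L = deduplicate _≟ʷ_ candidates
    sound : ∀ {V} → V ∈ L → Reduct W V
    sound m = reductsWithin-sound _ (∈-deduplicate⁻ _≟ʷ_ candidates m)
    complete : ∀ {V} → Reduct W V → V ∈ L
    complete r = ∈-deduplicate⁺ _≟ʷ_ (reductsWithin-complete _ ≤-refl r)

∈-++-∷⁻ : ∀ {z w : A} ys {zs} → z ∈ ys ++ w ∷ zs → z ≢ w → z ∈ ys ++ zs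
∈-++-∷⁻ [] (here refl) z≢w = ⊥-elim (z≢w refl)
∈-++-∷⁻ [] (there m) _ = m
∈-++-∷⁻ (_ ∷ ys) (here refl) _ = here refl
∈-++-∷⁻ (_ ∷ ys) (there m) z≢w = there (∈-++-∷⁻ ys m z≢w)

Unique-length-≤ : ∀ {xs ys : List A} → Unique xs → (∀ {z} → z ∈ xs → z ∈ ys) → length xs ≤ length ys
Unique-length-≤ {xs = []} _ _ = z≤n
Unique-length-≤ {xs = w ∷ xs} (w∉xs ∷ uxs) xs⊆ys with ∈-∃++ (xs⊆ys (here refl))
... | ys₁ , ys₂ , refl = subst (suc (length xs) ≤_) (sym (trans (length-++ ys₁) (+-suc _ _)))
  (s≤s (subst (length xs ≤_) (length-++ ys₁)
    (Unique-length-≤ uxs (λ z∈xs → ∈-++-∷⁻ ys₁ (xs⊆ys (there z∈xs)) (λ { refl → All.lookup w∉xs z∈xs refl })))))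

RCount-≥ : ∀ {W : List A} {m R} → RCount W m → Unique R → (∀ {V} → V ∈ R → Reduct W V) → length R ≤ m
RCount-≥ (L , (_ , L⇔) , refl) uR R⊆ = Unique-length-≤ uR (λ {V} V∈R → Equivalence.from (L⇔ V) (R⊆ V∈R))

RCount-positive : DecidableEquality A → ∀ {W : List A} {m} → RCount W m → 0 < m
RCount-positive _≟_ {W} rc with Reducts.reduct-exists _≟_ W
... | V , r = RCount-≥ rc ([] ∷ []) λ { (here refl) → r }

module _ {k : ℕ} where

  open Reducts (Fin._≟_ {k}) using (RCount-exists)

  FValue-≥ : ∀ {n m R} → FValue k n m → ∀ (W : List (Fin k)) → length W ≡ n →
             Unique R → (∀ {V} → V ∈ R → Reduct W V) → length R ≤ m
  FValue-≥ (_ , maximal) W |W|≡n uR R⊆ with RCount-exists W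
  ... | m′ , rc = ≤-trans (RCount-≥ rc uR R⊆) (maximal W m′ |W|≡n rc)

  FValue-positive : ∀ {n m} → FValue k n m → 0 < m
  FValue-positive ((_ , _ , rc) , _) = RCount-positive Fin._≟_ rc

∷-∷ʳ : ∀ {A : Set} (b : A) bs → ∃₂ λ cs c → b ∷ bs ≡ cs ∷ʳ c
∷-∷ʳ b [] = [] , b , refl
∷-∷ʳ b (b′ ∷ bs) with ∷-∷ʳ b′ bs
... | cs , c , eq = b ∷ cs , c , cong (b ∷_) eq

module Blocks {A : Set} (_≟_ : DecidableEquality A) (y : A) where

  consHead : A → List (List A) → List (List A)
  consHead c [] = [ [ c ] ]
  consHead c (b ∷ bs) = (c ∷ b) ∷ bs

  splitOn : List A → List (List A)
  splitOn [] = [ [] ]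
  splitOn (c ∷ w) with c ≟ y
  ... | yes _ = [] ∷ splitOn w
  ... | no _ = consHead c (splitOn w)

  infixr 5 _⊕_
  _⊕_ : List (List A) → List (List A) → List (List A)
  [] ⊕ cs = cs
  (b ∷ []) ⊕ [] = [ b ]
  (b ∷ []) ⊕ (c ∷ cs) = (b ++ c) ∷ cs
  (b ∷ b′ ∷ bs) ⊕ cs = b ∷ ((b′ ∷ bs) ⊕ cs)

  splitOn-∷ : ∀ w → ∃₂ λ b bs → splitOn w ≡ b ∷ bs
  splitOn-∷ [] = _ , _ , refl
  splitOn-∷ (c ∷ w) with c ≟ y
  ... | yes _ = _ , _ , refl
  ... | no _ with splitOn w | splitOn-∷ w
  ...   | _ | b , bs , refl = _ , _ , refl

  splitOn-∷ʳ : ∀ w → ∃₂ λ bs b → splitOn w ≡ bs ∷ʳ b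
  splitOn-∷ʳ w with splitOn-∷ w
  ... | b , bs , eq with ∷-∷ʳ b bs
  ...   | cs , c , eq′ = cs , c , trans eq eq′

  consHead-⊕ : ∀ c b bs d ds → consHead c ((b ∷ bs) ⊕ (d ∷ ds)) ≡ consHead c (b ∷ bs) ⊕ (d ∷ ds)
  consHead-⊕ c b [] d ds = refl
  consHead-⊕ c b (_ ∷ _) d ds = refl

  splitOn-++ : ∀ u v → splitOn (u ++ v) ≡ splitOn u ⊕ splitOn v
  splitOn-++ [] v with splitOn v | splitOn-∷ v
  ... | _ | _ , _ , refl = refl
  splitOn-++ (c ∷ u) v with c ≟ y
  ... | yes _ with splitOn u | splitOn-∷ u | splitOn-++ u v
  ...   | _ | _ , _ , refl | ih = cong ([] ∷_) ih
  splitOn-++ (c ∷ u) v | no _ with splitOn u | splitOn-∷ u | splitOn v | splitOn-∷ v | splitOn-++ u v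
  ...   | _ | b , bs , refl | _ | d , ds , refl | ih = trans (cong (consHead c) ih) (consHead-⊕ c b bs d ds)

  intercalate-consHead : ∀ c b bs → intercalate [ y ] (consHead c (b ∷ bs)) ≡ c ∷ intercalate [ y ] (b ∷ bs)
  intercalate-consHead c b [] = refl
  intercalate-consHead c b (_ ∷ _) = refl

  intercalate-splitOn : ∀ w → intercalate [ y ] (splitOn w) ≡ w
  intercalate-splitOn [] = refl
  intercalate-splitOn (c ∷ w) with c ≟ y
  ... | yes refl with splitOn w | splitOn-∷ w | intercalate-splitOn w
  ...   | _ | _ , _ , refl | ih = cong (y ∷_) ih
  intercalate-splitOn (c ∷ w) | no _ with splitOn w | splitOn-∷ w | intercalate-splitOn w
  ...   | _ | b , bs , refl | ih = trans (intercalate-consHead c b bs) (cong (c ∷_) ih)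

  splitOn-free : ∀ b → y ∉ b → splitOn b ≡ [ b ]
  splitOn-free [] _ = refl
  splitOn-free (c ∷ b) y∉ with c ≟ y
  ... | yes refl = ⊥-elim (y∉ (here refl))
  ... | no _ rewrite splitOn-free b (y∉ ∘ there) = refl

  splitOn-intercalate : ∀ b bs → All (y ∉_) (b ∷ bs) → splitOn (intercalate [ y ] (b ∷ bs)) ≡ b ∷ bs
  splitOn-intercalate b [] (y∉b ∷ []) = splitOn-free b y∉b
  splitOn-intercalate b (b′ ∷ bs) (y∉b ∷ y∉bs)
    rewrite splitOn-++ b (y ∷ intercalate [ y ] (b′ ∷ bs)) | splitOn-free b y∉b with y ≟ y
  ... | no y≢y = ⊥-elim (y≢y refl)
  ... | yes _ rewrite splitOn-intercalate b′ bs y∉bs | ++-identityʳ b = refl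

  splitOn-decomposition : ∀ b bs u X v → All (y ∉_) (b ∷ bs) → intercalate [ y ] (b ∷ bs) ≡ u ++ X ++ X ++ v →
                          b ∷ bs ≡ splitOn u ⊕ splitOn X ⊕ splitOn X ⊕ splitOn v
  splitOn-decomposition b bs u X v y∉bs eq = begin
    b ∷ bs                                    ≡⟨ splitOn-intercalate b bs y∉bs ⟨
    splitOn (intercalate [ y ] (b ∷ bs))      ≡⟨ cong splitOn eq ⟩
    splitOn (u ++ X ++ X ++ v)                ≡⟨ splitOn-++ u _ ⟩
    splitOn u ⊕ splitOn (X ++ X ++ v)         ≡⟨ cong (splitOn u ⊕_) (splitOn-++ X _) ⟩
    splitOn u ⊕ splitOn X ⊕ splitOn (X ++ v)  ≡⟨ cong (λ z → splitOn u ⊕ splitOn X ⊕ z) (splitOn-++ X v) ⟩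
    splitOn u ⊕ splitOn X ⊕ splitOn X ⊕ splitOn v ∎
    where open ≡-Reasoning

  cong⊕ : ∀ {s s′ t t′ w w′} → s ≡ s′ → t ≡ t′ → w ≡ w′ → s ⊕ t ⊕ t ⊕ w ≡ s′ ⊕ t′ ⊕ t′ ⊕ w′
  cong⊕ refl refl refl = refl

  ∷ʳ-⊕ : ∀ bs b c cs → (bs ∷ʳ b) ⊕ (c ∷ cs) ≡ bs ++ (b ++ c) ∷ cs
  ∷ʳ-⊕ [] b c cs = refl
  ∷ʳ-⊕ (_ ∷ []) b c cs = refl
  ∷ʳ-⊕ (d ∷ d′ ∷ bs) b c cs = cong (d ∷_) (∷ʳ-⊕ (d′ ∷ bs) b c cs)

  ⊕-square : ∀ us l P Bs Q r vs →
    (us ∷ʳ l) ⊕ ((P ∷ Bs) ∷ʳ Q) ⊕ ((P ∷ Bs) ∷ʳ Q) ⊕ (r ∷ vs) ≡ us ++ (l ++ P) ∷ Bs ++ (Q ++ P) ∷ Bs ++ (Q ++ r) ∷ vs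
  ⊕-square us l P Bs Q r vs = begin
    (us ∷ʳ l) ⊕ X ⊕ X ⊕ (r ∷ vs)                          ≡⟨ cong (λ z → (us ∷ʳ l) ⊕ X ⊕ z) (∷ʳ-⊕ (P ∷ Bs) Q r vs) ⟩
    (us ∷ʳ l) ⊕ X ⊕ (P ∷ Bs ++ (Q ++ r) ∷ vs)             ≡⟨ cong ((us ∷ʳ l) ⊕_) (∷ʳ-⊕ (P ∷ Bs) Q P _) ⟩
    (us ∷ʳ l) ⊕ (P ∷ Bs ++ (Q ++ P) ∷ Bs ++ (Q ++ r) ∷ vs) ≡⟨ ∷ʳ-⊕ us l P _ ⟩
    us ++ (l ++ P) ∷ Bs ++ (Q ++ P) ∷ Bs ++ (Q ++ r) ∷ vs  ∎
    where
    open ≡-Reasoning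
    X = (P ∷ Bs) ∷ʳ Q

  -- the square X X of the joined word with X = P y B₁ y ⋯ y Bₖ y Q, where Bs = B₁ ⋯ Bₖ
  data BlockSquare : List (List A) → Set where
    blockSquare : ∀ us l P Bs Q r vs → BlockSquare (us ++ (l ++ P) ∷ Bs ++ (Q ++ P) ∷ Bs ++ (Q ++ r) ∷ vs)

  HasSquare-intercalate : ∀ {bs} → All (y ∉_) bs → HasSquare (intercalate [ y ] bs) → Any HasSquare bs ⊎ BlockSquare bs
  HasSquare-intercalate {[]} _ sq = ⊥-elim (¬HasSquare-[] sq)
  HasSquare-intercalate {b ∷ bs} y∉bs (u , X , v , X≢[] , eq)
    with splitOn-∷ʳ u | splitOn-∷ X | splitOn-∷ v
  ... | us , l , eu | P , [] , eX | r , vs , ev =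
    inj₁ (lose (subst ((l ++ P ++ P ++ r) ∈_) (sym blocks) (∈-++⁺ʳ us (here refl))) (l , P , r , P≢[] , refl))
    where
    P≢[] : P ≢ []
    P≢[] P≡[] = X≢[] (trans (sym (intercalate-splitOn X)) (trans (cong (intercalate [ y ]) eX) P≡[]))
    blocks : b ∷ bs ≡ us ++ (l ++ P ++ P ++ r) ∷ vs
    blocks = trans (splitOn-decomposition b bs u X v y∉bs eq) (trans (cong⊕ eu eX ev) (∷ʳ-⊕ us l _ vs))
  ... | us , l , eu | P , B ∷ Bs , eX | r , vs , ev with ∷-∷ʳ B Bs
  ...   | Bs′ , Q , eB = inj₂ (subst BlockSquare (sym blocks) (blockSquare us l P Bs′ Q r vs))
    where
    blocks : b ∷ bs ≡ us ++ (l ++ P) ∷ Bs′ ++ (Q ++ P) ∷ Bs′ ++ (Q ++ r) ∷ vs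
    blocks = trans (splitOn-decomposition b bs u X v y∉bs eq)
               (trans (cong⊕ eu (trans eX (cong (P ∷_) eB)) ev) (⊕-square us l P Bs′ Q r vs))

  -- decode assigns each block a type; a block Q P wedged between blocks ending in P and
  -- beginning with Q must share the type of one of them
  module _ {B : Set} {Block : List A → Set} (decode : List A → B)
           (Block-y∉ : ∀ {b} → Block b → y ∉ b)
           (Block-squareFree : ∀ {b} → Block b → SquareFree b)
           (Block-overlap : ∀ l P Q r → Block (l ++ P) → Block (Q ++ P) → Block (Q ++ r) →
                            decode (Q ++ P) ≡ decode (l ++ P) ⊎ decode (Q ++ P) ≡ decode (Q ++ r)) where

    intercalate-squareFree : ∀ {bs} → All Block bs → SquareFree (map decode bs) → SquareFree (intercalate [ y ] bs)
    intercalate-squareFree blocks sf sq with HasSquare-intercalate (All.map Block-y∉ blocks) sq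
    ... | inj₁ blockWithSquare = All¬⇒¬Any (All.map Block-squareFree blocks) blockWithSquare
    ... | inj₂ (blockSquare us l P Bs Q r vs) =
      sf (subst HasSquare (sym (map-overlap decode us Bs vs _ _ _))
           (HasSquare-overlap (map decode us) (map decode Bs) (map decode vs)
             (Block-overlap l P Q r (block (∈-++⁺ʳ us (here refl)))
                            (block (∈-++⁺ʳ us (there (∈-++⁺ʳ Bs (here refl)))))
                            (block (∈-++⁺ʳ us (there (∈-++⁺ʳ Bs (there (∈-++⁺ʳ Bs (here refl))))))))))
      where
      block : ∀ {b} → b ∈ us ++ (l ++ P) ∷ Bs ++ (Q ++ P) ∷ Bs ++ (Q ++ r) ∷ vs → Block b
      block = All.lookup blocks

intercalate-[_] : ∀ {A : Set} (m : A) xs → intercalate [ m ] (map [_] xs) ≡ intersperse m xs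
intercalate-[ m ] [] = refl
intercalate-[ m ] (_ ∷ []) = refl
intercalate-[ m ] (z ∷ z′ ∷ zs) = cong (λ t → z ∷ m ∷ t) (intercalate-[ m ] (z′ ∷ zs))

module _ {C : Set} (_≟_ : DecidableEquality C) where

  open Blocks (≡-decᵐ _≟_) nothing

  Singleton : List (Maybe C) → Set
  Singleton s = ∃ λ c → s ≡ [ just c ]

  unwrap : List (Maybe C) → Maybe C
  unwrap (m ∷ []) = m
  unwrap _ = nothing

  Singleton-overlap : ∀ l P Q r → Singleton (l ++ P) → Singleton (Q ++ P) → Singleton (Q ++ r) →
                      unwrap (Q ++ P) ≡ unwrap (l ++ P) ⊎ unwrap (Q ++ P) ≡ unwrap (Q ++ r)
  Singleton-overlap [] P [] r _ _ _ = inj₁ refl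
  Singleton-overlap (_ ∷ _) [] [] r _ (_ , ()) _
  Singleton-overlap (_ ∷ []) (_ ∷ _) [] r (_ , ()) _ _
  Singleton-overlap (_ ∷ _ ∷ _) (_ ∷ _) [] r (_ , ()) _ _
  Singleton-overlap l [] (_ ∷ []) [] _ _ _ = inj₂ refl
  Singleton-overlap l [] (_ ∷ []) (_ ∷ _) _ _ (_ , ())
  Singleton-overlap l (_ ∷ _) (_ ∷ []) r _ (_ , ()) _
  Singleton-overlap l P (_ ∷ _ ∷ _) r _ (_ , ()) _

  Singleton-nothing∉ : ∀ {s} → Singleton s → nothing ∉ s
  Singleton-nothing∉ (c , refl) (here ())
  Singleton-nothing∉ (c , refl) (there ())

  Singleton-squareFree : ∀ {s} → Singleton s → SquareFree s
  Singleton-squareFree (c , refl) = ¬HasSquare-[ just c ]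

  intersperse-squareFree : ∀ w → SquareFree w → SquareFree (intersperse nothing (map just w))
  intersperse-squareFree w sf = subst SquareFree (intercalate-[ nothing ] (map just w))
    (intercalate-squareFree unwrap Singleton-nothing∉ Singleton-squareFree Singleton-overlap (singletons w)
      (subst SquareFree (sym (unwrap-singletons w)) (sf ∘ HasSquare-map⁻ just-injective w)))
    where
    singletons : ∀ w → All Singleton (map [_] (map just w))
    singletons [] = []
    singletons (c ∷ w) = (c , refl) ∷ singletons w
    unwrap-singletons : ∀ w → map unwrap (map [_] (map just w)) ≡ map just w
    unwrap-singletons [] = refl
    unwrap-singletons (c ∷ w) = cong (just c ∷_) (unwrap-singletons w)

F4 : Set
F4 = Fin 4

pattern α = zero
pattern β = suc zero
pattern χ = suc (suc zero)
pattern ♯ = suc (suc (suc zero))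

open Splits {F4}
open Reducts (Fin._≟_ {4}) using (hasSquare?)
open DecMembership (Fin._≟_ {4}) using (_∈?_)
private module Words = DecMembership (≡-dec (Fin._≟_ {4}))

code : F4 → List F4
code α = α ∷ β ∷ α ∷ []
code β = α ∷ χ ∷ α ∷ []
code χ = β ∷ α ∷ β ∷ []
code ♯ = β ∷ χ ∷ β ∷ []

decode : List F4 → Maybe F4
decode (α ∷ β ∷ α ∷ []) = just α
decode (α ∷ χ ∷ α ∷ []) = just β
decode (β ∷ α ∷ β ∷ []) = just χ
decode (β ∷ χ ∷ β ∷ []) = just ♯
decode _ = nothing

decode-code : ∀ c → decode (code c) ≡ just c
decode-code α = refl
decode-code β = refl
decode-code χ = refl
decode-code ♯ = refl

last-code : ∀ c → last (code c) ≢ just χ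
last-code α ()
last-code β ()
last-code χ ()
last-code ♯ ()

abstract
  ♯∉code : ∀ c → ♯ ∉ code c
  ♯∉code = from-yes (Fin.all? λ c → ¬? (♯ ∈? code c))

  code-squareFree : ∀ c → SquareFree (code c)
  code-squareFree = from-yes (Fin.all? λ c → ¬? (hasSquare? (code c)))

private abstract
  prefix-check : ∀ e d → code e ∈ prefixes (code d) → e ≡ d
  prefix-check = from-yes (Fin.all? λ e → Fin.all? λ d → (code e Words.∈? prefixes (code d)) →-dec (e Fin.≟ d))

  suffix-check : ∀ e c → code e ∈ suffixes (code c) → e ≡ c
  suffix-check = from-yes (Fin.all? λ e → Fin.all? λ c → (code e Words.∈? suffixes (code c)) →-dec (e Fin.≟ c))

  overlap-check : ∀ e → All (λ (Q , P) → ∀ c d → P ∈ suffixes (code c) → Q ∈ prefixes (code d) → e ≡ c ⊎ e ≡ d)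
                            (splits (code e))
  overlap-check = from-yes (Fin.all? λ e → All.all? (λ (Q , P) → Fin.all? λ c → Fin.all? λ d →
    (P Words.∈? suffixes (code c)) →-dec ((Q Words.∈? prefixes (code d)) →-dec ((e Fin.≟ c) ⊎-dec (e Fin.≟ d))))
    (splits (code e)))

code-prefix : ∀ {e d} r → code d ≡ code e ++ r → e ≡ d
code-prefix {e} {d} r eq = prefix-check e d (subst (λ w → code e ∈ prefixes w) (sym eq) (∈-prefixes⁺ (code e) r))

code-suffix : ∀ {e c} l → code c ≡ l ++ code e → e ≡ c
code-suffix {e} {c} l eq = suffix-check e c (subst (λ w → code e ∈ suffixes w) (sym eq) (∈-suffixes⁺ l (code e)))

code-overlap : ∀ {e c d} Q P l r → code e ≡ Q ++ P → code c ≡ l ++ P → code d ≡ Q ++ r → e ≡ c ⊎ e ≡ d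
code-overlap {e} {c} {d} Q P l r ee ec ed =
  All.lookup (overlap-check e) (subst (λ w → (Q , P) ∈ splits w) (sym ee) (∈-splits⁺ Q P)) c d
    (subst (λ w → P ∈ suffixes w) (sym ec) (∈-suffixes⁺ l P))
    (subst (λ w → Q ∈ prefixes w) (sym ed) (∈-prefixes⁺ Q r))

head-code : ∀ c → head (code c) ≢ just χ
head-code α ()
head-code β ()
head-code χ ()
head-code ♯ ()

code≢[] : ∀ c → code c ≢ []
code≢[] α ()
code≢[] β ()
code≢[] χ ()
code≢[] ♯ ()

Good : List F4 → Set
Good V = head V ≡ just χ × last V ≡ just χ × SquareFree V × ♯ ∉ V

Block : List F4 → Set
Block s = Good s ⊎ ∃ λ c → s ≡ code c

decode-χ : ∀ {s} → head s ≡ just χ → decode s ≡ nothing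
decode-χ {χ ∷ s} refl = refl

decode-≡ : ∀ {s s′ i i′} → s ≡ code i → s′ ≡ code i′ → i ≡ i′ → decode s ≡ decode s′
decode-≡ refl refl refl = refl

Block-♯∉ : ∀ {s} → Block s → ♯ ∉ s
Block-♯∉ (inj₁ (_ , _ , _ , ♯∉s)) = ♯∉s
Block-♯∉ (inj₂ (c , refl)) = ♯∉code c

Block-squareFree : ∀ {s} → Block s → SquareFree s
Block-squareFree (inj₁ (_ , _ , sf , _)) = sf
Block-squareFree (inj₂ (c , refl)) = code-squareFree c

Good-overlap : ∀ l P Q r → Good (Q ++ P) → Block (l ++ P) → Block (Q ++ r) →
               decode (Q ++ P) ≡ decode (l ++ P) ⊎ decode (Q ++ P) ≡ decode (Q ++ r)
Good-overlap l P [] r (hd , _) (inj₁ (hc , _)) _ = inj₁ (trans (decode-χ hd) (sym (decode-χ hc)))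
Good-overlap l [] [] r (() , _) (inj₂ _) _
Good-overlap l (p ∷ P) [] r (_ , le , _) (inj₂ (i , ec)) _ =
  ⊥-elim (last-code i (trans (cong last (sym ec)) (trans (last-++-∷ l p P) le)))
Good-overlap l P (q ∷ Q) r (he , _) _ (inj₁ (hd , _)) = inj₂ (trans (decode-χ he) (sym (decode-χ hd)))
Good-overlap l P (q ∷ Q) r (he , _) _ (inj₂ (k , ed)) = ⊥-elim (head-code k (trans (cong head (sym ed)) he))

code-Block-overlap : ∀ l P Q r {j} → Q ++ P ≡ code j → Block (l ++ P) → Block (Q ++ r) →
                     decode (Q ++ P) ≡ decode (l ++ P) ⊎ decode (Q ++ P) ≡ decode (Q ++ r)
code-Block-overlap l [] [] r {j} ee _ _ = ⊥-elim (code≢[] j (sym ee))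
code-Block-overlap l [] (q ∷ Q) r {j} ee _ (inj₁ (hd , _)) = ⊥-elim (head-code j (trans (cong head (sym ee)) hd))
code-Block-overlap l [] Q r {j} ee _ (inj₂ (k , ed)) =
  inj₂ (decode-≡ ee ed (code-prefix r (trans (sym ed) (cong (_++ r) (trans (sym (++-identityʳ Q)) ee)))))
code-Block-overlap l (p ∷ P) Q r {j} ee (inj₁ (_ , lc , _)) _ =
  ⊥-elim (last-code j (trans (cong last (sym ee)) (trans (last-++-∷ Q p P) (trans (sym (last-++-∷ l p P)) lc))))
code-Block-overlap l (p ∷ P) [] r {j} ee (inj₂ (i , ec)) _ =
  inj₁ (decode-≡ ee ec (code-suffix l (trans (sym ec) (cong (l ++_) ee))))
code-Block-overlap l (p ∷ P) (q ∷ Q) r {j} ee (inj₂ _) (inj₁ (hd , _)) =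
  ⊥-elim (head-code j (trans (cong head (sym ee)) hd))
code-Block-overlap l (p ∷ P) (q ∷ Q) r {j} ee (inj₂ (i , ec)) (inj₂ (k , ed))
  with code-overlap (q ∷ Q) (p ∷ P) l r (sym ee) (sym ec) (sym ed)
... | inj₁ j≡i = inj₁ (decode-≡ ee ec j≡i)
... | inj₂ j≡k = inj₂ (decode-≡ ee ed j≡k)

Block-overlap : ∀ l P Q r → Block (l ++ P) → Block (Q ++ P) → Block (Q ++ r) →
                decode (Q ++ P) ≡ decode (l ++ P) ⊎ decode (Q ++ P) ≡ decode (Q ++ r)
Block-overlap l P Q r bc (inj₁ ge) bd = Good-overlap l P Q r ge bc bd
Block-overlap l P Q r bc (inj₂ (j , ee)) bd = code-Block-overlap l P Q r ee bc bd

open Blocks (Fin._≟_ {4}) ♯ using (splitOn; splitOn-intercalate)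

Blocks-squareFree : ∀ {bs} → All Block bs → SquareFree (map decode bs) → SquareFree (intercalate [ ♯ ] bs)
Blocks-squareFree = Blocks.intercalate-squareFree Fin._≟_ ♯ decode Block-♯∉ Block-squareFree Block-overlap

data Woven (Rs : List (List F4)) : F4 → List F4 → List (List F4) → Set where
  single : ∀ c → Woven Rs c [] [ code c ]
  cons   : ∀ {c c′ t V bs} → V ∈ Rs → Woven Rs c′ t bs → Woven Rs c (c′ ∷ t) (code c ∷ V ∷ bs)

woven : List F4 → F4 → List F4 → List (List F4)
woven V c [] = [ code c ]
woven V c (c′ ∷ t) = code c ∷ V ∷ woven V c′ t

intercalate-woven : ∀ V U c t → intercalate [ ♯ ] (V ∷ woven U c t) ≡ V ++ [ ♯ ] ++ intercalate [ ♯ ] (woven U c t)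
intercalate-woven V U c [] = refl
intercalate-woven V U c (_ ∷ _) = refl

module _ {Rs : List (List F4)} where

  Woven-woven : ∀ {V} → V ∈ Rs → ∀ c t → Woven Rs c t (woven V c t)
  Woven-woven V∈ c [] = single c
  Woven-woven V∈ c (c′ ∷ t) = cons V∈ (Woven-woven V∈ c′ t)

  Woven-Blocks : (∀ {V} → V ∈ Rs → Good V) → ∀ {c t bs} → Woven Rs c t bs → All Block bs
  Woven-Blocks good (single c) = inj₂ (c , refl) ∷ []
  Woven-Blocks good (cons {c = c} V∈ w) = inj₂ (c , refl) ∷ inj₁ (good V∈) ∷ Woven-Blocks good w

  Woven-decode : (∀ {V} → V ∈ Rs → Good V) → ∀ {c t bs} → Woven Rs c t bs →
                 map decode bs ≡ intersperse nothing (map just (c ∷ t))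
  Woven-decode good (single c) = cong (_∷ []) (decode-code c)
  Woven-decode good (cons {c = c} V∈ w) =
    cong₂ _∷_ (decode-code c) (cong₂ _∷_ (decode-χ (proj₁ (good V∈))) (Woven-decode good w))

  Woven-squareFree : (∀ {V} → V ∈ Rs → Good V) → ∀ {c t bs} → SquareFree (c ∷ t) → Woven Rs c t bs →
                     SquareFree (intercalate [ ♯ ] bs)
  Woven-squareFree good {c} {t} sf w = Blocks-squareFree (Woven-Blocks good w)
    (subst SquareFree (sym (Woven-decode good w)) (intersperse-squareFree Fin._≟_ (c ∷ t) sf))

  Woven-splitOn : (∀ {V} → V ∈ Rs → Good V) → ∀ {c t bs} → Woven Rs c t bs → splitOn (intercalate [ ♯ ] bs) ≡ bs
  Woven-splitOn good w@(single _) = splitOn-intercalate _ _ (All.map Block-♯∉ (Woven-Blocks good w))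
  Woven-splitOn good w@(cons _ _) = splitOn-intercalate _ _ (All.map Block-♯∉ (Woven-Blocks good w))

  intercalate-Woven : ∀ V {c t bs} → Woven Rs c t bs → intercalate [ ♯ ] (V ∷ bs) ≡ V ++ [ ♯ ] ++ intercalate [ ♯ ] bs
  intercalate-Woven V (single _) = refl
  intercalate-Woven V (cons _ _) = refl

  Woven-⟶* : ∀ {U} → (∀ {V} → V ∈ Rs → U ⟶* V) → ∀ {c t bs} → Woven Rs c t bs →
             intercalate [ ♯ ] (woven U c t) ⟶* intercalate [ ♯ ] bs
  Woven-⟶* reach (single c) = ε
  Woven-⟶* {U} reach (cons {c = c} {c′} {t} {V} V∈ w) =
    subst₂ _⟶*_ (cong (λ z → code c ++ [ ♯ ] ++ z) (sym (intercalate-woven U U c′ t)))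
                (cong (λ z → code c ++ [ ♯ ] ++ z) (sym (intercalate-Woven V w)))
      (⟶*-++ˡ (code c) (⟶*-++ˡ [ ♯ ]
        (⟶*-++ʳ ([ ♯ ] ++ _) (reach V∈) ◅◅ ⟶*-++ˡ V (⟶*-++ˡ [ ♯ ] (Woven-⟶* reach w)))))

length-code : ∀ c → length (code c) ≡ 3
length-code α = refl
length-code β = refl
length-code χ = refl
length-code ♯ = refl

length-woven : ∀ V c t → length (intercalate [ ♯ ] (woven V c t)) ≡ 3 + length t * (length V + 5)
length-woven V c [] = length-code c
length-woven V c (c′ ∷ t) = begin
  length (code c ++ [ ♯ ] ++ intercalate [ ♯ ] (V ∷ woven V c′ t))
    ≡⟨ cong (λ z → length (code c ++ [ ♯ ] ++ z)) (intercalate-woven V V c′ t) ⟩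
  length (code c ++ ♯ ∷ V ++ ♯ ∷ intercalate [ ♯ ] (woven V c′ t))
    ≡⟨ length-++ (code c) ⟩
  length (code c) + suc (length (V ++ ♯ ∷ intercalate [ ♯ ] (woven V c′ t)))
    ≡⟨ cong₂ (λ m n → m + suc n) (length-code c) (length-++ V) ⟩
  3 + suc (length V + suc (length (intercalate [ ♯ ] (woven V c′ t))))
    ≡⟨ cong (λ n → 3 + suc (length V + suc n)) (length-woven V c′ t) ⟩
  3 + suc (length V + suc (3 + length t * (length V + 5)))
    ≡⟨ arith (length V) (length t) ⟩
  3 + length (c′ ∷ t) * (length V + 5) ∎
  where
  open ≡-Reasoning
  arith : ∀ v k → 3 + suc (v + suc (3 + k * (v + 5))) ≡ 3 + suc k * (v + 5)
  arith = solve-∀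

wovens : List (List F4) → F4 → List F4 → List (List (List F4))
wovens Rs c [] = [ [ code c ] ]
wovens Rs c (c′ ∷ t) = cartesianProductWith (λ V bs → code c ∷ V ∷ bs) Rs (wovens Rs c′ t)

∈-wovens⁻ : ∀ Rs c t {bs} → bs ∈ wovens Rs c t → Woven Rs c t bs
∈-wovens⁻ Rs c [] (here refl) = single c
∈-wovens⁻ Rs c (c′ ∷ t) bs∈ with ∈-cartesianProductWith⁻ (λ V bs → code c ∷ V ∷ bs) Rs (wovens Rs c′ t) bs∈
... | V , bs′ , V∈ , bs′∈ , refl = cons V∈ (∈-wovens⁻ Rs c′ t bs′∈)

wovens-unique : ∀ {Rs} c t → Unique Rs → Unique (wovens Rs c t)
wovens-unique c [] _ = [] ∷ []
wovens-unique c (c′ ∷ t) uRs = Unique.cartesianProductWith⁺ (λ V bs → code c ∷ V ∷ bs)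
  (λ eq → ∷-injectiveˡ (∷-injectiveʳ eq) , ∷-injectiveʳ (∷-injectiveʳ eq)) uRs (wovens-unique c′ t uRs)

length-wovens : ∀ Rs c t → length (wovens Rs c t) ≡ length Rs ^ length t
length-wovens Rs c [] = refl
length-wovens Rs c (c′ ∷ t) =
  trans (length-cartesianProductWith _ Rs (wovens Rs c′ t)) (cong (length Rs *_) (length-wovens Rs c′ t))

Good-[χ] : Good [ χ ]
Good-[χ] = refl , refl , ¬HasSquare-[ χ ] , λ { (here ()) ; (there ()) }

grow : List F4 → List F4
grow [] = []
grow (c ∷ t) = intercalate [ ♯ ] (woven [ χ ] c t)

grow-squareFree : ∀ w → SquareFree w → SquareFree (grow w)
grow-squareFree [] _ = ¬HasSquare-[]
grow-squareFree (c ∷ t) sf = Woven-squareFree {[ [ χ ] ]} (λ { (here refl) → Good-[χ] ; (there ()) }) sf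
                                (Woven-woven (here refl) c t)

squareFreeWord : ℕ → List F4
squareFreeWord zero = [ α ]
squareFreeWord (suc i) = grow (squareFreeWord i)

squareFreeWord-squareFree : ∀ i → SquareFree (squareFreeWord i)
squareFreeWord-squareFree zero = ¬HasSquare-[ α ]
squareFreeWord-squareFree (suc i) = grow-squareFree _ (squareFreeWord-squareFree i)

squareFreeWord-length : ∀ i → i < length (squareFreeWord i)
squareFreeWord-length zero = s≤s z≤n
squareFreeWord-length (suc i) with squareFreeWord i | squareFreeWord-length i
... | c ∷ t | s≤s i≤|t| rewrite length-woven [ χ ] c t =
  s≤s (s≤s (≤-trans i≤|t| (≤-trans (m≤m*n (length t) 6) (n≤1+n _))))

squareFree-of-length : ∀ k → ∃ λ (t : List F4) → length t ≡ k × SquareFree t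
squareFree-of-length k = take k w , trans (length-take k w) (m≤n⇒m⊓n≡m (<⇒≤ (squareFreeWord-length k))) ,
                         squareFreeWord-squareFree k ∘ HasSquare-take k w
  where w = squareFreeWord k

open Defs using (a; b; x)

embed : Letter → F4
embed a = α
embed b = β
embed x = χ

embed-injective : Injective _≡_ _≡_ embed
embed-injective {a} {a} _ = refl
embed-injective {b} {b} _ = refl
embed-injective {x} {x} _ = refl

_≟ˡ_ : DecidableEquality Letter
p ≟ˡ q = map′ embed-injective (cong embed) (embed p Fin.≟ embed q)

♯∉embed : ∀ w → ♯ ∉ map embed w
♯∉embed (a ∷ w) (here ())
♯∉embed (b ∷ w) (here ())
♯∉embed (x ∷ w) (here ())
♯∉embed (_ ∷ w) (there ♯∈) = ♯∉embed w ♯∈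

module Construction (U : List Letter) (head-U : head U ≡ just x) (last-U : last U ≡ just x)
                    {L : List (List Letter)} (unique-L : Unique L) (L⇔ : ∀ V → (V ∈ L) ⇔ Reduct U V) where

  U⁺ : List F4
  U⁺ = map embed U

  Rs : List (List F4)
  Rs = map (map embed) L

  Rs-reduct : ∀ {V} → V ∈ Rs → ∃ λ V₀ → V ≡ map embed V₀ × Reduct U V₀
  Rs-reduct V∈ with ∈-map⁻ (map embed) V∈
  ... | V₀ , V₀∈ , refl = V₀ , refl , Equivalence.to (L⇔ V₀) V₀∈

  Rs-Good : ∀ {V} → V ∈ Rs → Good V
  Rs-Good V∈ with Rs-reduct V∈
  ... | V₀ , refl , U⟶*V₀ , sf =
    trans (head-map {f = embed} V₀) (cong (Maybe.map embed) (trans (⟶*-head U⟶*V₀) head-U)) ,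
    trans (last-map embed V₀) (cong (Maybe.map embed) (trans (⟶*-last U⟶*V₀) last-U)) ,
    sf ∘ HasSquare-map⁻ embed-injective V₀ ,
    ♯∉embed V₀

  Rs-⟶* : ∀ {V} → V ∈ Rs → U⁺ ⟶* V
  Rs-⟶* V∈ with Rs-reduct V∈
  ... | V₀ , refl , U⟶*V₀ , _ = ⟶*-map embed U⟶*V₀

  Rs-unique : Unique Rs
  Rs-unique = Unique.map⁺ (map-injective embed-injective) unique-L

  -- the first separator is padded to reach an arbitrary length
  padded : ℕ → F4 → F4 → List F4 → List F4
  padded j c c′ t = code c ++ replicate j ♯ ++ ♯ ∷ intercalate [ ♯ ] (U⁺ ∷ woven U⁺ c′ t)

  length-padded : ∀ j c c′ t → length (padded j c c′ t) ≡ j + (3 + length (c′ ∷ t) * (length U + 5))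
  length-padded j c c′ t = begin
    length (padded j c c′ t)
      ≡⟨ length-++-replicate (code c) j ♯ _ ⟩
    j + length (intercalate [ ♯ ] (woven U⁺ c (c′ ∷ t)))
      ≡⟨ cong (j +_) (length-woven U⁺ c (c′ ∷ t)) ⟩
    j + (3 + length (c′ ∷ t) * (length U⁺ + 5))
      ≡⟨ cong (λ l → j + (3 + length (c′ ∷ t) * (l + 5))) (length-map embed U) ⟩
    j + (3 + length (c′ ∷ t) * (length U + 5))
      ∎
    where open ≡-Reasoning

  woven-reducts : F4 → List F4 → List (List F4)
  woven-reducts c t = map (intercalate [ ♯ ]) (wovens Rs c t)

  woven-reducts-unique : ∀ c t → Unique (woven-reducts c t)
  woven-reducts-unique c t =
    Unique.map⁻ (subst Unique (sym splitOn-intercalate-wovens) (wovens-unique c t Rs-unique))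
    where
    splitOn-intercalate-wovens : map splitOn (woven-reducts c t) ≡ wovens Rs c t
    splitOn-intercalate-wovens = trans (sym (map-∘ (wovens Rs c t)))
                                       (map-id-local (tabulate (Woven-splitOn Rs-Good ∘ ∈-wovens⁻ Rs c t)))

  length-woven-reducts : ∀ c t → length (woven-reducts c t) ≡ length L ^ length t
  length-woven-reducts c t =
    trans (length-map _ (wovens Rs c t)) (trans (length-wovens Rs c t) (cong (_^ length t) (length-map _ L)))

  woven-reducts-reduct : ∀ j c c′ t → SquareFree (c ∷ c′ ∷ t) →
                         ∀ {V} → V ∈ woven-reducts c (c′ ∷ t) → Reduct (padded j c c′ t) V
  woven-reducts-reduct j c c′ t sf V∈ with ∈-map⁻ (intercalate [ ♯ ]) V∈
  ... | bs , bs∈ , refl = ⟶*-++ˡ (code c) (replicate-⟶* j ♯ _) ◅◅ Woven-⟶* Rs-⟶* woven-bs ,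
                          Woven-squareFree Rs-Good sf woven-bs
    where woven-bs = ∈-wovens⁻ Rs c (c′ ∷ t) bs∈

  ℓ : ℕ
  ℓ = length U + 5

  instance
    ℓ-nonZero : NonZero ℓ
    ℓ-nonZero = >-nonZero (≤-trans (s≤s z≤n) (m≤n+m 5 (length U)))

    L-nonZero : NonZero (length L)
    L-nonZero = >-nonZero (RCount-positive _≟ˡ_ (L , (unique-L , L⇔) , refl))

  FValue-bound : ∀ {n m} → FValue 4 n m → length L ^ (n / ℓ ∸ 1) ≤ m
  FValue-bound {n} {m} fv with n / ℓ in eq
  ... | zero = FValue-positive fv
  ... | suc zero = FValue-positive fv
  ... | suc (suc k) with squareFree-of-length (suc (suc k))
  ...   | c ∷ c′ ∷ t , refl , sf =
    subst (_≤ m) (length-woven-reducts c (c′ ∷ t))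
      (FValue-≥ fv (padded j c c′ t) (trans (length-padded j c c′ t) (m∸n+n≡m fits))
                (woven-reducts-unique c (c′ ∷ t)) (woven-reducts-reduct j c c′ t sf))
    where
    3≤ℓ : 3 ≤ ℓ
    3≤ℓ = ≤-trans (s≤s (s≤s (s≤s z≤n))) (m≤n+m 5 (length U))
    fits : 3 + suc k * ℓ ≤ n
    fits = ≤-trans (+-monoˡ-≤ (suc k * ℓ) 3≤ℓ) (subst (λ K → K * ℓ ≤ n) eq (m/n*n≤m n ℓ))
    j = n ∸ (3 + suc k * ℓ)

theorem2p9 : ∀ (U : List Letter) → head U ≡ just x → last U ≡ just x →
    ∀ (rU : ℕ) → RCount U rU →
    ∃ λ (p : ℕ) → ∃ λ (q : ℕ) → 0 < p × 0 < q ×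
      (∀ (n m : ℕ) → FValue 4 n m → p * rU ^ n ≤ q * m ^ (length U + 5))
theorem2p9 U head-U last-U .(length L) (L , (unique-L , L⇔) , refl) =
  1 , length L ^ (ℓ + ℓ) , s≤s z≤n , m^n>0 (length L) (ℓ + ℓ) ,
  λ n m fv → subst (_≤ _) (sym (*-identityˡ _)) (^-≤-quotient ℓ n (FValue-bound fv))
  where open Construction U head-U last-U unique-L L⇔
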